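{- Let $\mathfrak{D} = \langle \mathfrak{M}, \star\rangle$ be a class of dynamic models. The following axiom schema is valid in $\mathfrak{D}$ for any $\varphi \in \mathcal{L}_0$ and $\xi \in \mathcal{L}_\leq(\star)$ iff $\star$ is $\mathfrak{M}$-CR3-compliant: $$ {}[\star \varphi][<](\neg \varphi \rightarrow \xi) \rightarrow (\varphi \rightarrow [<] [\star \varphi] (\neg \varphi \rightarrow \xi))$$
   Context: Fix a set $P$ of propositional letters; $\mathcal{L}_0$ is the classical propositional language over $P$. A (well-founded) preference model is $M=\langle W,\leq,v\rangle$ with $W$ a set of worlds, $\leq$ a reflexive, transitive relation on $W$ whose strict part $<$ is well-founded, and $v:P\to 2^W$ a valuation; $\mathit{Mod}(\mathcal{L}_\leq)$ is the class of all such models. A dynamic operator is a map $\star:\mathit{Mod}(\mathcal{L}_\leq)\times\mathcal{L}_0\to\mathit{Mod}(\mathcal{L}_\leq)$ with $\star(M,\varphi)=\langle W,\leq_{\star\varphi},v\rangle$ (same worlds and valuation). The language $\mathcal{L}_\leq(\star)$ is built from $P$ with $\neg,\wedge$, the universal modality $A$, the modalities $[\leq]$, $[<]$, and formulas $[\star\varphi]\xi$ with $\varphi\in\mathcal{L}_0$. A dynamic model is $D=\langle M,\star\rangle$, with $D,w\vDash A\xi$ iff every world satisfies $\xi$, $D,w\vDash[\leq]\xi$ iff every $w'\leq w$ satisfies $\xi$, $D,w\vDash[<]\xi$ iff every $w'<w$ satisfies $\xi$, and $D,w\vDash[\star\varphi]\xi$ iff $\langle\star(M,\varphi),\star\rangle,w\vDash\xi$.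 For a class $\mathfrak{M}$ of preference models over which $\star$ is closed, $\mathfrak{D}=\langle\mathfrak{M},\star\rangle$ is the class of dynamic models $\langle M,\star\rangle$ with $M\in\mathfrak{M}$; a formula is valid in $\mathfrak{D}$ if it is true at every world of every such model. $[\![\varphi]\!]$ denotes the set of worlds of the model under consideration satisfying $\varphi$. $\star$ is $\mathfrak{M}$-CR3-compliant if for every $M=\langle W,\leq,v\rangle\in\mathfrak{M}$, every $\varphi\in\mathcal{L}_0$ and all $w,w'\in W$, with $D=\langle M,\star\rangle$: (CR3a) if $w\notin[\![\varphi]\!]$, $w'\in[\![\varphi]\!]$ and $w<w'$, then for every information $\xi$ with $D,w\vDash[\star\varphi]\xi$ there is $w''\notin[\![\varphi]\!]$ with $D,w''\vDash[\star\varphi]\xi$ and $w''<_{\star\varphi}w'$. -}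

module Defs where

open import Level using (0ℓ)
open import Data.Product using (Σ; ∃; _×_; _,_)
open import Relation.Nullary using (¬_)
open import Induction.WellFounded using (WellFounded)

Strict : {W : Set} → (W → W → Set) → W → W → Set
Strict _≤_ x y = x ≤ y × ¬ (y ≤ x)

record PrefOrder (W : Set) : Set₁ where
  field
    _≤_   : W → W → Set
    ≤-refl  : ∀ {x} → x ≤ x
    ≤-trans : ∀ {x y z} → x ≤ y → y ≤ z → x ≤ z
    <-wf    : WellFounded (Strict _≤_)

record PrefModel (P : Set) : Set₁ where
  field
    W   : Set
    ord : PrefOrder W
    v   : P → W → Set

open PrefModel public

Lt : {P : Set} (M : PrefModel P) → W M → W M → Set
Lt M = Strict (PrefOrder._≤_ (ord M))

data L0 (P : Set) : Set where
  atom : P → L0 P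
  neg  : L0 P → L0 P
  and  : L0 P → L0 P → L0 P

sat0 : {P : Set} (M : PrefModel P) → W M → L0 P → Set
sat0 M w (atom p)  = v M p w
sat0 M w (neg φ)   = ¬ sat0 M w φ
sat0 M w (and φ ψ) = sat0 M w φ × sat0 M w ψ

DynOp : Set → Set₁
DynOp P = (M : PrefModel P) → L0 P → PrefOrder (W M)

update : {P : Set} → DynOp P → (M : PrefModel P) → L0 P → PrefModel P
update ⋆ M φ = record { W = W M ; ord = ⋆ M φ ; v = v M }

data Form (P : Set) : Set where
  atom : P → Form P
  neg  : Form P → Form P
  and  : Form P → Form P → Form P
  univ : Form P → Form P
  box≤ : Form P → Form P
  box< : Form P → Form P
  dyn  : L0 P → Form P → Form P

emb : {P : Set} → L0 P → Form P
emb (atom p)  = atom p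
emb (neg φ)   = neg (emb φ)
emb (and φ ψ) = and (emb φ) (emb ψ)

imp : {P : Set} → Form P → Form P → Form P
imp a b = neg (and a (neg b))

sat : {P : Set} → DynOp P → (M : PrefModel P) → W M → Form P → Set
sat ⋆ M w (atom p)  = v M p w
sat ⋆ M w (neg ξ)   = ¬ sat ⋆ M w ξ
sat ⋆ M w (and ξ η) = sat ⋆ M w ξ × sat ⋆ M w η
sat ⋆ M w (univ ξ)  = ∀ w' → sat ⋆ M w' ξ
sat ⋆ M w (box≤ ξ)  = ∀ w' → PrefOrder._≤_ (ord M) w' w → sat ⋆ M w' ξ
sat ⋆ M w (box< ξ)  = ∀ w' → Lt M w' w → sat ⋆ M w' ξ
sat ⋆ M w (dyn φ ξ) = sat ⋆ (update ⋆ M φ) w ξ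

Closed : {P : Set} → (PrefModel P → Set) → DynOp P → Set₁
Closed 𝔐 ⋆ = ∀ M φ → 𝔐 M → 𝔐 (update ⋆ M φ)

Valid : {P : Set} → (PrefModel P → Set) → DynOp P → Form P → Set₁
Valid 𝔐 ⋆ χ = ∀ M → 𝔐 M → ∀ w → sat ⋆ M w χ

schema43 : {P : Set} → L0 P → Form P → Form P
schema43 φ ξ =
  imp (dyn φ (box< (imp (neg (emb φ)) ξ)))
      (imp (emb φ) (box< (dyn φ (imp (neg (emb φ)) ξ))))

CR3Compliant : {P : Set} → (PrefModel P → Set) → DynOp P → Set₁
CR3Compliant {P} 𝔐 ⋆ =
  ∀ (M : PrefModel P) → 𝔐 M → ∀ (φ : L0 P) (w w' : W M) →
    ¬ sat0 M w φ → sat0 M w' φ → Lt M w w' →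
    ∀ (ξ : Form P) → sat ⋆ M w (dyn φ ξ) →
    Σ (W M) λ w'' → ¬ sat0 M w'' φ × sat ⋆ M w'' (dyn φ ξ)
                    × Lt (update ⋆ M φ) w'' w'

-- Both directions instantiate the other side at ¬ξ. If CR3 holds and the schema
-- failed at a φ-world u, some w < u would satisfy ¬φ and [⋆φ]¬ξ; CR3 supplies a
-- ¬φ-world w'' <⋆φ u with [⋆φ]¬ξ, contradicting [⋆φ][<](¬φ → ξ) at u. Conversely,
-- if CR3 failed for w < w' and ξ, then no ¬φ-world w'' <⋆φ w' satisfies [⋆φ]ξ,
-- i.e. [⋆φ][<](¬φ → ¬ξ) holds at w'; the schema for ¬ξ then gives [⋆φ](¬φ → ¬ξ)
-- at w, clashing with ¬φ and [⋆φ]ξ there. Extracting the CR3 witness from this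
-- contradiction is the one classical step.
module Submission where

open import Defs
open import Level using (0ℓ)
open import Axiom.ExcludedMiddle using (ExcludedMiddle)
open import Axiom.DoubleNegationElimination using (em⇒dne)
open import Function.Bundles using (_⇔_; mk⇔; Equivalence)
import Function.Properties.Equivalence as ⇔
open import Data.Product using (_,_)
open import Relation.Nullary.Negation using (contraposition)

open Equivalence using (to; from)

module _ {P : Set} (⋆ : DynOp P) where

  sat-emb : (M : PrefModel P) (w : W M) (ψ : L0 P) → sat ⋆ M w (emb ψ) ⇔ sat0 M w ψ
  sat-emb M w (atom p)  = mk⇔ (λ s → s) (λ s → s)
  sat-emb M w (neg ψ)   = mk⇔ (contraposition (from (sat-emb M w ψ)))
                              (contraposition (to (sat-emb M w ψ)))
  sat-emb M w (and ψ θ) = mk⇔ (λ (a , b) → to (sat-emb M w ψ) a , to (sat-emb M w θ) b)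
                              (λ (a , b) → from (sat-emb M w ψ) a , from (sat-emb M w θ) b)

  sat0-update : (M : PrefModel P) (φ : L0 P) (w : W M) (ψ : L0 P) →
                sat0 (update ⋆ M φ) w ψ ⇔ sat0 M w ψ
  sat0-update M φ w (atom p)  = mk⇔ (λ s → s) (λ s → s)
  sat0-update M φ w (neg ψ)   = mk⇔ (contraposition (from (sat0-update M φ w ψ)))
                                    (contraposition (to (sat0-update M φ w ψ)))
  sat0-update M φ w (and ψ θ) =
    mk⇔ (λ (a , b) → to (sat0-update M φ w ψ) a , to (sat0-update M φ w θ) b)
        (λ (a , b) → from (sat0-update M φ w ψ) a , from (sat0-update M φ w θ) b)

  sat-emb-update : (M : PrefModel P) (φ : L0 P) (w : W M) (ψ : L0 P) →
                   sat ⋆ (update ⋆ M φ) w (emb ψ) ⇔ sat0 M w ψ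
  sat-emb-update M φ w ψ = ⇔.trans (sat-emb (update ⋆ M φ) w ψ) (sat0-update M φ w ψ)

  module _ (𝔐 : PrefModel P → Set) where

    CR3Compliant⇒schema43-valid : CR3Compliant 𝔐 ⋆ →
                                   ∀ φ ξ → Valid 𝔐 ⋆ (schema43 φ ξ)
    CR3Compliant⇒schema43-valid cr3 φ ξ M M∈𝔐 u (premise , ¬conclusion) =
      ¬conclusion λ (φu , ¬below) → ¬below λ w w<u (¬φw , ¬ξw) →
        let w'' , ¬φw'' , ¬ξw'' , w''<u =
              cr3 M M∈𝔐 φ w u (contraposition (from (sat-emb-update M φ w φ)) ¬φw)
                  (to (sat-emb M u φ) φu) w<u (neg ξ) ¬ξw
        in premise w'' w''<u (contraposition (to (sat-emb-update M φ w'' φ)) ¬φw'' , ¬ξw'')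

    schema43-valid⇒CR3Compliant : ExcludedMiddle 0ℓ →
                                   (∀ φ ξ → Valid 𝔐 ⋆ (schema43 φ ξ)) → CR3Compliant 𝔐 ⋆
    schema43-valid⇒CR3Compliant em valid M M∈𝔐 φ w w' ¬φw φw' w<w' ξ ξw =
      em⇒dne em λ noWitness →
        let premise : sat ⋆ M w' (dyn φ (box< (imp (neg (emb φ)) (neg ξ))))
            premise z z<w' (¬φz , ¬¬ξz) = ¬¬ξz λ ξz →
              noWitness (z , contraposition (from (sat-emb-update M φ z φ)) ¬φz , ξz , z<w')
        in valid φ (neg ξ) M M∈𝔐 w'
             (premise , λ conclusion → conclusion
               (from (sat-emb M w' φ) φw' , λ below → below w w<w'
                 (contraposition (to (sat-emb-update M φ w φ)) ¬φw , λ ¬ξw → ¬ξw ξw)))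

proposition43 : ExcludedMiddle 0ℓ → {P : Set} (𝔐 : PrefModel P → Set) (⋆ : DynOp P) →
    Closed 𝔐 ⋆ →
    ((∀ (φ : L0 P) (ξ : Form P) → Valid 𝔐 ⋆ (schema43 φ ξ)) ⇔ CR3Compliant 𝔐 ⋆)
proposition43 em 𝔐 ⋆ _ =
  mk⇔ (schema43-valid⇒CR3Compliant ⋆ 𝔐 em) (CR3Compliant⇒schema43-valid ⋆ 𝔐)
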